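{- Let $\mathcal{F}\subseteq\{0,1\}^n$ be a family of vectors, each of Hamming weight $w$, such that $\langle u,v\rangle\le\epsilon w$ for all distinct $u,v\in\mathcal{F}$, and let $M$ be a positive integer. For every $\mathbf{I}\subseteq\mathcal{F}$, if $\epsilon\in(0,1/(10|\mathbf{I}|))$, then for every $x,x'\in[m]^n$ one has either $\mathrm{subspace}_{\mathbf{I}}(x)=\mathrm{subspace}_{\mathbf{I}}(x')$ or $\mathrm{subspace}_{\mathbf{I}}(x)\cap\mathrm{subspace}_{\mathbf{I}}(x')=\emptyset$.
   Context: $[m]=\{0,\dots,m-1\}$; $\langle\cdot,\cdot\rangle$ is the standard inner product on $\mathbb{Z}^n$. For $\mathbf{I}\subseteq\mathcal{F}$ and $x\in[m]^n$, $\mathrm{block}_{\mathbf{I}}(x)=(\lfloor\langle x,\mathbf{i}\rangle/M\rfloor)_{\mathbf{i}\in\mathbf{I}}$, and $$\mathrm{subspace}_{\mathbf{I}}(x)=\Big\{x'\in[m]^n:\ x'=x+\sum_{\mathbf{i}\in\mathbf{I}}t_{\mathbf{i}}\,\mathbf{i}\ \text{for some } t\in\mathbb{Z}^{\mathbf{I}} \text{ with } \|t\|_\infty\le 2M/w \text{ and } \mathrm{block}_{\mathbf{I}}(x')=\mathrm{block}_{\mathbf{I}}(x)\Big\}.$$ -}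

module Defs where

open import Data.Nat as ℕ using (ℕ; zero; suc; NonZero; _<_; _≟_)
open import Data.Nat.DivMod using (_/_)
open import Data.Integer as ℤ using (ℤ; +_)
open import Data.Fin using (Fin)
open import Data.Vec as Vec using (Vec; zipWith; count)
open import Data.Vec.Relation.Unary.All as VAll using ()
open import Data.List as List using (List; length)
open import Data.List.Membership.Propositional using (_∈_)
open import Data.List.Relation.Unary.Unique.Propositional using (Unique)
open import Data.Product using (Σ; _×_)
open import Data.Sum using (_⊎_)
open import Relation.Binary.PropositionalEquality using (_≡_)
open import Relation.Nullary.Decidable using (¬?)
import Data.Rational as ℚ

-- standard inner product on ℕ^n (vectors in [m]^n and {0,1}^n are ℕ-vectors)
⟪_,_⟫ : ∀ {n} → Vec ℕ n → Vec ℕ n → ℕ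
⟪ u , v ⟫ = Vec.sum (zipWith ℕ._*_ u v)

IsBinary : ∀ {n} → Vec ℕ n → Set
IsBinary = VAll.All (λ a → a ≡ 0 ⊎ a ≡ 1)

hammingWeight : ∀ {n} → Vec ℕ n → ℕ
hammingWeight = count (λ a → ¬? (a ≟ 0))

-- x ∈ [m]^n, [m] = {0,…,m-1}
InRange : ∀ {n} → ℕ → Vec ℕ n → Set
InRange m = VAll.All (_< m)

sumℤ : ∀ K → (Fin K → ℤ) → ℤ
sumℤ zero f = + 0
sumℤ (suc K) f = f Fin.zero ℤ.+ sumℤ K (λ k → f (Fin.suc k))
  where import Data.Fin as Fin

block : ∀ {n} (M : ℕ) .{{_ : NonZero M}} → List (Vec ℕ n) → Vec ℕ n → List ℕ
block M I x = List.map (λ i → ⟪ x , i ⟫ / M) I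

InSubspace : ∀ {n} (m w M : ℕ) .{{_ : NonZero w}} .{{_ : NonZero M}}
           → List (Vec ℕ n) → Vec ℕ n → Vec ℕ n → Set
InSubspace {n} m w M I x x' =
  InRange m x' ×
  Σ (Fin (length I) → ℤ) λ t →
    (∀ k → (+ ℤ.∣ t k ∣) ℚ./ 1 ℚ.≤ (+ (2 ℕ.* M)) ℚ./ w) ×
    (∀ (j : Fin n) → + Vec.lookup x' j ≡
        + Vec.lookup x j ℤ.+ sumℤ (length I) (λ k → t k ℤ.* + Vec.lookup (List.lookup I k) j)) ×
    block M I x' ≡ block M I x

-- Write a point y of subspace_I(x) as y = x + Σₖ tₖ iₖ and let k₀ maximise |tₖ|. Pairing with
-- i_{k₀} gives t_{k₀}·w = ⟨y,i_{k₀}⟩ − ⟨x,i_{k₀}⟩ − Σ_{k≠k₀} tₖ⟨iₖ,i_{k₀}⟩. Equal blocks bound the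
-- first difference by M, and almost-orthogonality (used only as 2|I|⟨iⱼ,iₖ⟩ ≤ w) bounds the sum
-- by |t_{k₀}|·w/2, so |tₖ|·w ≤ 2M holds automatically. Hence subspace_I(x) is the class of x
-- under the equivalence relation "y − x is an integer combination of I and y has the same
-- blocks as x", and whether x' lies in the class of x is decided by a bounded search.
module Submission where

open import Defs
import Algebra.Properties.Semiring.Sum as Sum
open import Data.Nat as ℕ using (ℕ; zero; suc; NonZero; _≤_; _<_; s≤s; z≤n)
import Data.Nat.Properties as ℕP
import Data.Nat.Tactic.RingSolver as ℕRing
open import Data.Nat.DivMod using (_/_; _%_; m≡m%n+[m/n]*n; m%n<n)
open import Data.Integer as ℤ using (ℤ; +_; -[1+_]; ∣_∣)
import Data.Integer.Properties as ℤP
open import Data.Integer.Tactic.RingSolver using (solve-∀)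
open import Data.Nat.Coprimality using (Coprime)
open import Data.Rational as ℚ using (ℚ; mkℚ; 0ℚ; 1ℚ; toℚᵘ)
import Data.Rational.Properties as ℚP
open import Data.Rational.Unnormalised as ℚᵘ using (mkℚᵘ; *≤*; *<*; *≡*)
import Data.Rational.Unnormalised.Properties as ℚᵘP
open import Data.Fin using (Fin; zero; suc; punchIn)
import Data.Fin.Properties as FinP
open import Data.Vec using (Vec; []; _∷_; lookup)
import Data.Vec.Functional as Vector
import Data.Vec.Relation.Unary.All as VAll
open import Data.List as List using (List; length)
import Data.List.Properties as ListP
open import Data.List.Membership.Propositional using (_∈_)
open import Data.List.Membership.Propositional.Properties using (∈-lookup)
open import Data.List.Relation.Unary.Unique.Propositional using (Unique)
open import Data.List.Relation.Unary.All as All using (All)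
import Data.List.Relation.Unary.AllPairs as AllPairs
open import Data.Product using (∃; _×_; _,_; proj₁; proj₂)
open import Data.Sum using (_⊎_; inj₁; inj₂)
open import Data.Empty using (⊥; ⊥-elim)
open import Function.Base using (_∘_)
open import Function.Bundles using (_⇔_; mk⇔; Equivalence)
open import Relation.Nullary using (Dec; yes; no; map′; _×-dec_; _⊎-dec_)
open import Relation.Unary using (Decidable)
open import Relation.Binary.PropositionalEquality

module ℤSum = Sum ℤP.+-*-semiring
module ℕSum = Sum ℕP.+-*-semiring

∑ : ∀ {K} → (Fin K → ℤ) → ℤ
∑ = ℤSum.sum

∑ℕ : ∀ {K} → (Fin K → ℕ) → ℕ
∑ℕ = ℕSum.sum

sumℤ≡∑ : ∀ K (f : Fin K → ℤ) → sumℤ K f ≡ ∑ f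
sumℤ≡∑ zero    f = refl
sumℤ≡∑ (suc K) f = cong (ℤ._+_ (f zero)) (sumℤ≡∑ K (f ∘ suc))

sumℤ-cong : ∀ K {f g : Fin K → ℤ} → (∀ k → f k ≡ g k) → sumℤ K f ≡ sumℤ K g
sumℤ-cong K {f} {g} f≗g = trans (sumℤ≡∑ K f) (trans (ℤSum.sum-cong-≗ f≗g) (sym (sumℤ≡∑ K g)))

∑-neg : ∀ {K} (f : Fin K → ℤ) → ∑ (ℤ.-_ ∘ f) ≡ ℤ.- ∑ f
∑-neg f = begin
  ∑ (ℤ.-_ ∘ f)              ≡⟨ ℤSum.sum-cong-≗ (λ k → sym (ℤP.-1*i≡-i (f k))) ⟩
  ∑ (λ k → ℤ.-1ℤ ℤ.* f k)   ≡⟨ ℤSum.*-distribˡ-sum ℤ.-1ℤ f ⟨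
  ℤ.-1ℤ ℤ.* ∑ f             ≡⟨ ℤP.-1*i≡-i (∑ f) ⟩
  ℤ.- ∑ f                   ∎
  where open ≡-Reasoning

∣∑∣≤∑∣∣ : ∀ {K} (f : Fin K → ℤ) → ∣ ∑ f ∣ ≤ ∑ℕ (∣_∣ ∘ f)
∣∑∣≤∑∣∣ {zero}  f = z≤n
∣∑∣≤∑∣∣ {suc K} f = ℕP.≤-trans (ℤP.∣i+j∣≤∣i∣+∣j∣ (f zero) _)
                                (ℕP.+-monoʳ-≤ ∣ f zero ∣ (∣∑∣≤∑∣∣ (f ∘ suc)))

∑ℕ-mono-≤ : ∀ {K} {f g : Fin K → ℕ} → (∀ k → f k ≤ g k) → ∑ℕ f ≤ ∑ℕ g
∑ℕ-mono-≤ {zero}  f≤g = z≤n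
∑ℕ-mono-≤ {suc K} f≤g = ℕP.+-mono-≤ (f≤g zero) (∑ℕ-mono-≤ (f≤g ∘ suc))

∑ℕ≤*-const : ∀ {K} {f : Fin K → ℕ} {c} → (∀ k → f k ≤ c) → ∑ℕ f ≤ K ℕ.* c
∑ℕ≤*-const {zero}  f≤c = z≤n
∑ℕ≤*-const {suc K} f≤c = ℕP.+-mono-≤ (f≤c zero) (∑ℕ≤*-const (f≤c ∘ suc))

+⟪⟫≡∑ : ∀ {n} (u v : Vec ℕ n) → + ⟪ u , v ⟫ ≡ ∑ (λ j → + lookup u j ℤ.* + lookup v j)
+⟪⟫≡∑ []      []      = refl
+⟪⟫≡∑ (a ∷ u) (b ∷ v) = trans (ℤP.pos-+ (a ℕ.* b) _) (cong₂ ℤ._+_ (ℤP.pos-* a b) (+⟪⟫≡∑ u v))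

⟪u,u⟫≡hammingWeight : ∀ {n} (u : Vec ℕ n) → IsBinary u → ⟪ u , u ⟫ ≡ hammingWeight u
⟪u,u⟫≡hammingWeight []       VAll.[]                = refl
⟪u,u⟫≡hammingWeight (.0 ∷ u) (inj₁ refl VAll.∷ u01) = ⟪u,u⟫≡hammingWeight u u01
⟪u,u⟫≡hammingWeight (.1 ∷ u) (inj₂ refl VAll.∷ u01) = cong suc (⟪u,u⟫≡hammingWeight u u01)

m/d≡n/d⇒∣m-n∣<d : ∀ a b d .{{_ : NonZero d}} → a / d ≡ b / d → ∣ + a ℤ.- + b ∣ < d
m/d≡n/d⇒∣m-n∣<d a b d a/d≡b/d = begin-strict
  ∣ + a ℤ.- + b ∣                 ≡⟨ cong ∣_∣ (cong₂ ℤ._-_ (split a refl) (split b (sym a/d≡b/d))) ⟩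
  ∣ (+ r ℤ.+ + q) ℤ.- (+ s ℤ.+ + q) ∣ ≡⟨ cong ∣_∣ (trans (cancel (+ r) (+ s) (+ q)) (ℤP.m-n≡m⊖n r s)) ⟩
  ∣ r ℤ.⊖ s ∣                     ≤⟨ ℤP.∣m⊝n∣≤m⊔n r s ⟩
  r ℕ.⊔ s                         <⟨ ℕP.⊔-lub (m%n<n a d) (m%n<n b d) ⟩
  d                               ∎
  where
  open ℕP.≤-Reasoning
  r s q : ℕ
  r = a % d
  s = b % d
  q = (a / d) ℕ.* d
  split : ∀ c → c / d ≡ a / d → + c ≡ + (c % d) ℤ.+ + q
  split c c/d≡a/d = trans (cong +_ (trans (m≡m%n+[m/n]*n c d) (cong (λ z → c % d ℕ.+ z ℕ.* d) c/d≡a/d)))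
                          (ℤP.pos-+ (c % d) q)
  cancel : ∀ x y z → (x ℤ.+ z) ℤ.- (y ℤ.+ z) ≡ x ℤ.- y
  cancel = solve-∀

argmax-∣∣ : ∀ {L} (t : Fin (suc L) → ℤ) → ∃ λ k₀ → ∀ k → ∣ t k ∣ ≤ ∣ t k₀ ∣
argmax-∣∣ {zero} t = zero , λ { zero → ℕP.≤-refl }
argmax-∣∣ {suc L} t with argmax-∣∣ (t ∘ suc)
... | k₁ , max₁ with ∣ t zero ∣ ℕ.≤? ∣ t (suc k₁) ∣
...   | yes t₀≤t₁ = suc k₁ , λ { zero → t₀≤t₁ ; (suc k) → max₁ k }
...   | no  t₀≰t₁ = zero , λ { zero → ℕP.≤-refl
                           ; (suc k) → ℕP.≤-trans (max₁ k) (ℕP.<⇒≤ (ℕP.≰⇒> t₀≰t₁)) }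

m≤n+o∧2o≤m⇒m≤2n : ∀ {m n o} → m ≤ n ℕ.+ o → 2 ℕ.* o ≤ m → m ≤ 2 ℕ.* n
m≤n+o∧2o≤m⇒m≤2n {m} {n} {o} m≤n+o 2o≤m = ℕP.+-cancelʳ-≤ m m (2 ℕ.* n) (begin
  m ℕ.+ m                       ≤⟨ ℕP.+-mono-≤ m≤n+o m≤n+o ⟩
  (n ℕ.+ o) ℕ.+ (n ℕ.+ o)       ≡⟨ double n o ⟩
  2 ℕ.* n ℕ.+ 2 ℕ.* o           ≤⟨ ℕP.+-monoʳ-≤ (2 ℕ.* n) 2o≤m ⟩
  2 ℕ.* n ℕ.+ m                 ∎)
  where
  open ℕP.≤-Reasoning
  double : ∀ n o → (n ℕ.+ o) ℕ.+ (n ℕ.+ o) ≡ 2 ℕ.* n ℕ.+ 2 ℕ.* o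
  double = ℕRing.solve-∀

module _ {n L : ℕ} (v : Fin L → Vec ℕ n) where

  Offset : (Fin L → ℤ) → Vec ℕ n → Vec ℕ n → Set
  Offset t x y = ∀ j → + lookup y j ≡ + lookup x j ℤ.+ ∑ (λ k → t k ℤ.* + lookup (v k) j)

  offset-sym : ∀ {t x y} → Offset t x y → Offset (ℤ.-_ ∘ t) y x
  offset-sym {t} {x} {y} x→y j = begin
    + lookup x j                                 ≡⟨ shift (+ lookup x j) S ⟩
    (+ lookup x j ℤ.+ S) ℤ.+ ℤ.- S               ≡⟨ cong₂ ℤ._+_ (x→y j) negated ⟨
    + lookup y j ℤ.+ ∑ (λ k → ℤ.- t k ℤ.* a k)   ∎
    where
    open ≡-Reasoning
    a : Fin L → ℤ
    a k = + lookup (v k) j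
    S : ℤ
    S = ∑ (λ k → t k ℤ.* a k)
    shift : ∀ x s → x ≡ (x ℤ.+ s) ℤ.+ ℤ.- s
    shift = solve-∀
    negated : ∑ (λ k → ℤ.- t k ℤ.* a k) ≡ ℤ.- S
    negated = trans (ℤSum.sum-cong-≗ (λ k → sym (ℤP.neg-distribˡ-* (t k) (a k)))) (∑-neg (λ k → t k ℤ.* a k))

  offset-trans : ∀ {s t x y z} → Offset s x y → Offset t y z → Offset (λ k → s k ℤ.+ t k) x z
  offset-trans {s} {t} {x} {y} {z} x→y y→z j = begin
    + lookup z j                                      ≡⟨ y→z j ⟩
    + lookup y j ℤ.+ ∑ tₐ                             ≡⟨ cong (ℤ._+ ∑ tₐ) (x→y j) ⟩
    + lookup x j ℤ.+ ∑ sₐ ℤ.+ ∑ tₐ                    ≡⟨ ℤP.+-assoc (+ lookup x j) (∑ sₐ) (∑ tₐ) ⟩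
    + lookup x j ℤ.+ (∑ sₐ ℤ.+ ∑ tₐ)                  ≡⟨ cong (ℤ._+_ (+ lookup x j)) (ℤSum.∑-distrib-+ sₐ tₐ) ⟨
    + lookup x j ℤ.+ ∑ (λ k → sₐ k ℤ.+ tₐ k)          ≡⟨ cong (ℤ._+_ (+ lookup x j)) (ℤSum.sum-cong-≗ λ k →
                                                           sym (ℤP.*-distribʳ-+ (a k) (s k) (t k))) ⟩
    + lookup x j ℤ.+ ∑ (λ k → (s k ℤ.+ t k) ℤ.* a k)  ∎
    where
    open ≡-Reasoning
    a sₐ tₐ : Fin L → ℤ
    a k = + lookup (v k) j
    sₐ k = s k ℤ.* a k
    tₐ k = t k ℤ.* a k

  offset-⟪⟫ : ∀ {t x y} → Offset t x y → ∀ h →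
              + ⟪ y , h ⟫ ≡ + ⟪ x , h ⟫ ℤ.+ ∑ (λ k → t k ℤ.* + ⟪ v k , h ⟫)
  offset-⟪⟫ {t} {x} {y} x→y h = begin
    + ⟪ y , h ⟫                                       ≡⟨ +⟪⟫≡∑ y h ⟩
    ∑ (λ j → + lookup y j ℤ.* c j)                    ≡⟨ ℤSum.sum-cong-≗ (λ j → cong (ℤ._* c j) (x→y j)) ⟩
    ∑ (λ j → (+ lookup x j ℤ.+ S j) ℤ.* c j)          ≡⟨ ℤSum.sum-cong-≗ (λ j → ℤP.*-distribʳ-+ (c j) (+ lookup x j) (S j)) ⟩
    ∑ (λ j → + lookup x j ℤ.* c j ℤ.+ S j ℤ.* c j)    ≡⟨ ℤSum.∑-distrib-+ (λ j → + lookup x j ℤ.* c j) (λ j → S j ℤ.* c j) ⟩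
    ∑ (λ j → + lookup x j ℤ.* c j) ℤ.+ ∑ (λ j → S j ℤ.* c j)
                                                      ≡⟨ cong₂ ℤ._+_ (sym (+⟪⟫≡∑ x h)) swapped ⟩
    + ⟪ x , h ⟫ ℤ.+ ∑ (λ k → t k ℤ.* + ⟪ v k , h ⟫)   ∎
    where
    open ≡-Reasoning
    c : Fin n → ℤ
    c j = + lookup h j
    S : Fin n → ℤ
    S j = ∑ (λ k → t k ℤ.* + lookup (v k) j)
    swapped : ∑ (λ j → S j ℤ.* c j) ≡ ∑ (λ k → t k ℤ.* + ⟪ v k , h ⟫)
    swapped = begin
      ∑ (λ j → S j ℤ.* c j)                                 ≡⟨ ℤSum.sum-cong-≗ (λ j → ℤSum.*-distribʳ-sum (c j) (λ k → t k ℤ.* + lookup (v k) j)) ⟩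
      ∑ (λ j → ∑ (λ k → t k ℤ.* + lookup (v k) j ℤ.* c j))  ≡⟨ ℤSum.∑-comm (λ k j → t k ℤ.* + lookup (v k) j ℤ.* c j) ⟨
      ∑ (λ k → ∑ (λ j → t k ℤ.* + lookup (v k) j ℤ.* c j))  ≡⟨ ℤSum.sum-cong-≗ (λ k → ℤSum.sum-cong-≗ λ j →
                                                                 ℤP.*-assoc (t k) (+ lookup (v k) j) (c j)) ⟩
      ∑ (λ k → ∑ (λ j → t k ℤ.* (+ lookup (v k) j ℤ.* c j))) ≡⟨ ℤSum.sum-cong-≗ (λ k →
                                                                 ℤSum.*-distribˡ-sum (t k) (λ j → + lookup (v k) j ℤ.* c j)) ⟨
      ∑ (λ k → t k ℤ.* ∑ (λ j → + lookup (v k) j ℤ.* c j))  ≡⟨ ℤSum.sum-cong-≗ (λ k → cong (t k ℤ.*_) (+⟪⟫≡∑ (v k) h)) ⟨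
      ∑ (λ k → t k ℤ.* + ⟪ v k , h ⟫)                       ∎

offDiagonal-≤ : ∀ {n L w} (v : Fin (suc L) → Vec ℕ n) →
                (∀ j k → j ≢ k → 2 ℕ.* suc L ℕ.* ⟪ v j , v k ⟫ ≤ w) →
                ∀ k → 2 ℕ.* ∑ℕ (Vector.removeAt (λ j → ⟪ v j , v k ⟫) k) ≤ w
offDiagonal-≤ {L = L} {w} v v-orth k = ℕP.*-cancelˡ-≤ (suc L) (begin
  suc L ℕ.* (2 ℕ.* S)                                    ≡⟨ reassoc (suc L) S ⟩
  2 ℕ.* suc L ℕ.* S                                      ≡⟨ ℕSum.*-distribˡ-sum (2 ℕ.* suc L) e ⟩
  ∑ℕ (λ j → 2 ℕ.* suc L ℕ.* ⟪ v (punchIn k j) , v k ⟫)  ≤⟨ ∑ℕ≤*-const (λ j → v-orth _ k (FinP.punchInᵢ≢i k j)) ⟩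
  L ℕ.* w                                                ≤⟨ ℕP.m≤n+m (L ℕ.* w) w ⟩
  suc L ℕ.* w                                            ∎)
  where
  open ℕP.≤-Reasoning
  e : Fin L → ℕ
  e = Vector.removeAt (λ j → ⟪ v j , v k ⟫) k
  S : ℕ
  S = ∑ℕ e
  reassoc : ∀ l s → l ℕ.* (2 ℕ.* s) ≡ 2 ℕ.* l ℕ.* s
  reassoc = ℕRing.solve-∀

dominant-coefficient-bound :
  ∀ {n L w M} .{{_ : NonZero M}} (v : Fin (suc L) → Vec ℕ n) → (∀ k → ⟪ v k , v k ⟫ ≡ w) →
  ∀ {t x y} → Offset v t x y → ∀ k₀ → ⟪ y , v k₀ ⟫ / M ≡ ⟪ x , v k₀ ⟫ / M →
  (∀ k → ∣ t k ∣ ≤ ∣ t k₀ ∣) →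
  ∣ t k₀ ∣ ℕ.* w ≤ M ℕ.+ ∣ t k₀ ∣ ℕ.* ∑ℕ (Vector.removeAt (λ j → ⟪ v j , v k₀ ⟫) k₀)
dominant-coefficient-bound {w = w} {M} v v-norm {t} {x} {y} x→y k₀ same-block t≤t₀ = begin
  C ℕ.* w                                          ≡⟨ ℤP.∣i*j∣≡∣i∣*∣j∣ (t k₀) (+ w) ⟨
  ∣ t k₀ ℤ.* + w ∣                                 ≡⟨ cong ∣_∣ isolated ⟩
  ∣ (+ B ℤ.- + A) ℤ.- R ∣                          ≤⟨ ℤP.∣i-j∣≤∣i∣+∣j∣ (+ B ℤ.- + A) R ⟩
  ∣ + B ℤ.- + A ∣ ℕ.+ ∣ R ∣                        ≤⟨ ℕP.+-mono-≤ (ℕP.<⇒≤ (m/d≡n/d⇒∣m-n∣<d B A M same-block))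
                                                                    (∣∑∣≤∑∣∣ r) ⟩
  M ℕ.+ ∑ℕ (λ j → ∣ t (punchIn k₀ j) ℤ.* + e j ∣)  ≤⟨ ℕP.+-monoʳ-≤ M off-diagonal-terms ⟩
  M ℕ.+ ∑ℕ (λ j → C ℕ.* e j)                        ≡⟨ cong (M ℕ.+_) (ℕSum.*-distribˡ-sum C e) ⟨
  M ℕ.+ C ℕ.* ∑ℕ e                                  ∎
  where
  open ℕP.≤-Reasoning
  C A B : ℕ
  C = ∣ t k₀ ∣
  A = ⟪ x , v k₀ ⟫
  B = ⟪ y , v k₀ ⟫
  e : Fin _ → ℕ
  e = Vector.removeAt (λ j → ⟪ v j , v k₀ ⟫) k₀
  r : Fin _ → ℤ
  r = Vector.removeAt (λ k → t k ℤ.* + ⟪ v k , v k₀ ⟫) k₀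
  R : ℤ
  R = ∑ r
  expanded : + B ≡ + A ℤ.+ (t k₀ ℤ.* + w ℤ.+ R)
  expanded = trans (offset-⟪⟫ v {t} {x} {y} x→y (v k₀))
                   (cong (ℤ._+_ (+ A)) (trans (ℤSum.sum-remove {i = k₀} (λ k → t k ℤ.* + ⟪ v k , v k₀ ⟫))
                                           (cong (λ z → t k₀ ℤ.* + z ℤ.+ R) (v-norm k₀))))
  solve-for : ∀ a b r → b ≡ ((a ℤ.+ (b ℤ.+ r)) ℤ.- a) ℤ.- r
  solve-for = solve-∀
  isolated : t k₀ ℤ.* + w ≡ (+ B ℤ.- + A) ℤ.- R
  isolated = trans (solve-for (+ A) _ R) (cong (λ z → (z ℤ.- + A) ℤ.- R) (sym expanded))
  off-diagonal-terms : ∑ℕ (λ j → ∣ t (punchIn k₀ j) ℤ.* + e j ∣) ≤ ∑ℕ (λ j → C ℕ.* e j)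
  off-diagonal-terms = ∑ℕ-mono-≤ λ j →
    ℕP.≤-trans (ℕP.≤-reflexive (ℤP.∣i*j∣≡∣i∣*∣j∣ (t (punchIn k₀ j)) _)) (ℕP.*-monoˡ-≤ (e j) (t≤t₀ _))

offset-coefficient-bound :
  ∀ {n L w M} .{{_ : NonZero M}} (v : Fin L → Vec ℕ n) → (∀ k → ⟪ v k , v k ⟫ ≡ w) →
  (∀ j k → j ≢ k → 2 ℕ.* L ℕ.* ⟪ v j , v k ⟫ ≤ w) →
  ∀ {t x y} → Offset v t x y → (∀ k → ⟪ y , v k ⟫ / M ≡ ⟪ x , v k ⟫ / M) →
  ∀ k → ∣ t k ∣ ℕ.* w ≤ 2 ℕ.* M
offset-coefficient-bound {L = suc L} {w} {M} v v-norm v-orth {t} {x} {y} x→y same-blocks k =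
  ℕP.≤-trans (ℕP.*-monoˡ-≤ w (t≤t₀ k)) (m≤n+o∧2o≤m⇒m≤2n {n = M} dominant half)
  where
  k₀ : Fin (suc L)
  k₀ = proj₁ (argmax-∣∣ t)
  t≤t₀ : ∀ k → ∣ t k ∣ ≤ ∣ t k₀ ∣
  t≤t₀ = proj₂ (argmax-∣∣ t)
  C S : ℕ
  C = ∣ t k₀ ∣
  S = ∑ℕ (Vector.removeAt (λ j → ⟪ v j , v k₀ ⟫) k₀)
  dominant : C ℕ.* w ≤ M ℕ.+ C ℕ.* S
  dominant = dominant-coefficient-bound v v-norm {t} {x} {y} x→y k₀ (same-blocks k₀) t≤t₀
  reassoc : ∀ c s → 2 ℕ.* (c ℕ.* s) ≡ c ℕ.* (2 ℕ.* s)
  reassoc = ℕRing.solve-∀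
  half : 2 ℕ.* (C ℕ.* S) ≤ C ℕ.* w
  half = ℕP.≤-trans (ℕP.≤-reflexive (reassoc C S)) (ℕP.*-monoʳ-≤ C (offDiagonal-≤ v v-orth k₀))

toℚᵘ-ℕ/ : ∀ a d → toℚᵘ ((+ a) ℚ./ suc d) ℚᵘ.≃ mkℚᵘ (+ a) d
toℚᵘ-ℕ/ a d = ℚP.toℚᵘ-fromℚᵘ (mkℚᵘ (+ a) d)

ℕ/1≤ℕ/w⇔*≤ : ∀ a b w .{{_ : NonZero w}} → ((+ a) ℚ./ 1 ℚ.≤ (+ b) ℚ./ w) ⇔ (a ℕ.* w ≤ b)
ℕ/1≤ℕ/w⇔*≤ a b (suc w) = mk⇔ to from
  where
  to : (+ a) ℚ./ 1 ℚ.≤ (+ b) ℚ./ suc w → a ℕ.* suc w ≤ b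
  to a≤b with ℚᵘP.≤-respʳ-≃ (toℚᵘ-ℕ/ b w) (ℚᵘP.≤-respˡ-≃ (toℚᵘ-ℕ/ a 0) (ℚP.toℚᵘ-mono-≤ a≤b))
  ... | *≤* le = ℤP.drop‿+≤+ (subst₂ ℤ._≤_ (sym (ℤP.pos-* a (suc w))) (ℤP.*-identityʳ (+ b)) le)
  from : a ℕ.* suc w ≤ b → (+ a) ℚ./ 1 ℚ.≤ (+ b) ℚ./ suc w
  from le = ℚP.toℚᵘ-cancel-≤ (ℚᵘP.≤-respʳ-≃ (ℚᵘP.≃-sym (toℚᵘ-ℕ/ b w)) (ℚᵘP.≤-respˡ-≃ (ℚᵘP.≃-sym (toℚᵘ-ℕ/ a 0))
    (*≤* (subst₂ ℤ._≤_ (ℤP.pos-* a (suc w)) (sym (ℤP.*-identityʳ (+ b))) (ℤ.+≤+ le)))))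

toℚᵘ-mkℚ*ℕ : ∀ p d .(c : Coprime p (suc d)) b → toℚᵘ (mkℚ (+ p) d c ℚ.* ((+ b) ℚ./ 1)) ℚᵘ.≃ mkℚᵘ (+ (p ℕ.* b)) d
toℚᵘ-mkℚ*ℕ p d c b = ℚᵘP.≃-trans (ℚP.toℚᵘ-homo-* (mkℚ (+ p) d c) ((+ b) ℚ./ 1))
  (ℚᵘP.≃-trans (ℚᵘP.*-congˡ {mkℚᵘ (+ p) d} (toℚᵘ-ℕ/ b 0))
               (*≡* (trans (cong (ℤ._* + suc d) (sym (ℤP.pos-* p b)))
                           (cong (λ z → + (p ℕ.* b) ℤ.* + suc z) (sym (ℕP.*-identityʳ d))))))

e≤εw∧10Lε<1⇒2Le≤w : ∀ {ε : ℚ} {e w L} → 0ℚ ℚ.< ε →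
                   (+ e) ℚ./ 1 ℚ.≤ ε ℚ.* ((+ w) ℚ./ 1) → ε ℚ.* ((+ (10 ℕ.* L)) ℚ./ 1) ℚ.< 1ℚ →
                   2 ℕ.* L ℕ.* e ≤ w
e≤εw∧10Lε<1⇒2Le≤w {mkℚ -[1+ _ ] _ _} ε>0 _ _ with ℚ.positive ε>0
... | ()
e≤εw∧10Lε<1⇒2Le≤w {mkℚ (+ p) d c} {e} {w} {L} _ e≤εw 10Lε<1 = ℕP.*-cancelˡ-≤ (suc d) (begin
  suc d ℕ.* (2 ℕ.* L ℕ.* e)     ≡⟨ swap (suc d) (2 ℕ.* L) e ⟩
  2 ℕ.* L ℕ.* (suc d ℕ.* e)     ≤⟨ ℕP.*-monoʳ-≤ (2 ℕ.* L) d·e≤p·w ⟩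
  2 ℕ.* L ℕ.* (p ℕ.* w)         ≤⟨ ℕP.*-monoˡ-≤ (p ℕ.* w) (ℕP.*-monoˡ-≤ L (ℕP.m≤m+n 2 8)) ⟩
  10 ℕ.* L ℕ.* (p ℕ.* w)        ≡⟨ regroup p L w ⟩
  p ℕ.* (10 ℕ.* L) ℕ.* w        ≤⟨ ℕP.*-monoˡ-≤ w (ℕP.<⇒≤ p·10L<d) ⟩
  suc d ℕ.* w                   ∎)
  where
  open ℕP.≤-Reasoning
  swap : ∀ a b c → a ℕ.* (b ℕ.* c) ≡ b ℕ.* (a ℕ.* c)
  swap = ℕRing.solve-∀
  regroup : ∀ p L w → 10 ℕ.* L ℕ.* (p ℕ.* w) ≡ p ℕ.* (10 ℕ.* L) ℕ.* w
  regroup = ℕRing.solve-∀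
  d·e≤p·w : suc d ℕ.* e ≤ p ℕ.* w
  d·e≤p·w with ℚᵘP.≤-respʳ-≃ (toℚᵘ-mkℚ*ℕ p d c w) (ℚᵘP.≤-respˡ-≃ (toℚᵘ-ℕ/ e 0) (ℚP.toℚᵘ-mono-≤ e≤εw))
  ... | *≤* le = ℤP.drop‿+≤+ (subst₂ ℤ._≤_ (trans (sym (ℤP.pos-* e (suc d))) (cong +_ (ℕP.*-comm e (suc d))))
                                           (ℤP.*-identityʳ _) le)
  p·10L<d : p ℕ.* (10 ℕ.* L) < suc d
  p·10L<d with ℚᵘP.<-respˡ-≃ (toℚᵘ-mkℚ*ℕ p d c (10 ℕ.* L)) (ℚP.toℚᵘ-mono-< 10Lε<1)
  ... | *<* lt = ℤP.drop‿+<+ (subst₂ ℤ._<_ (ℤP.*-identityʳ _) (ℤP.*-identityˡ (+ suc d)) lt)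

∃-bounded-ℤ? : ∀ {Q : ℤ → Set} B → Decidable Q → Dec (∃ λ h → ∣ h ∣ ≤ B × Q h)
∃-bounded-ℤ? {Q} B Q? = map′ to from (ℕP.anyUpTo? (λ a → Q? (+ a) ⊎-dec Q? (ℤ.- + a)) (suc B))
  where
  to : (∃ λ a → a < suc B × (Q (+ a) ⊎ Q (ℤ.- + a))) → ∃ λ h → ∣ h ∣ ≤ B × Q h
  to (a , s≤s a≤B , inj₁ q) = + a , a≤B , q
  to (a , s≤s a≤B , inj₂ q) = ℤ.- + a , subst (_≤ B) (sym (ℤP.∣-i∣≡∣i∣ (+ a))) a≤B , q
  from : (∃ λ h → ∣ h ∣ ≤ B × Q h) → ∃ λ a → a < suc B × (Q (+ a) ⊎ Q (ℤ.- + a))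
  from (+ a      , a≤B , q) = a , s≤s a≤B , inj₁ q
  from (-[1+ a ] , a≤B , q) = suc a , s≤s a≤B , inj₂ q

∃-bounded? : ∀ L B {P : (Fin L → ℤ) → Set} → Decidable P →
             (∀ {t t'} → (∀ k → t k ≡ t' k) → P t → P t') →
             Dec (∃ λ t → (∀ k → ∣ t k ∣ ≤ B) × P t)
∃-bounded? zero    B P? P-resp = map′ (λ p → t₀ , (λ ()) , p) (λ (_ , _ , p) → P-resp (λ ()) p) (P? t₀)
  where
  t₀ : Fin 0 → ℤ
  t₀ ()
∃-bounded? (suc L) B {P} P? P-resp = map′ to from
  (∃-bounded-ℤ? B (λ h → ∃-bounded? L B (P? ∘ (h Vector.∷_))
                                        (λ t≗t' → P-resp λ { zero → refl ; (suc k) → t≗t' k })))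
  where
  to : (∃ λ h → ∣ h ∣ ≤ B × ∃ λ t → (∀ k → ∣ t k ∣ ≤ B) × P (h Vector.∷ t)) →
       ∃ λ t → (∀ k → ∣ t k ∣ ≤ B) × P t
  to (h , h≤B , t , t≤B , p) = h Vector.∷ t , (λ { zero → h≤B ; (suc k) → t≤B k }) , p
  from : (∃ λ t → (∀ k → ∣ t k ∣ ≤ B) × P t) →
         ∃ λ h → ∣ h ∣ ≤ B × ∃ λ t → (∀ k → ∣ t k ∣ ≤ B) × P (h Vector.∷ t)
  from (t , t≤B , p) = t zero , t≤B zero , t ∘ suc , t≤B ∘ suc , P-resp (λ { zero → refl ; (suc k) → refl }) p

map-≡⇒lookup-≡ : ∀ {A B : Set} {f g : A → B} (xs : List A) → List.map f xs ≡ List.map g xs →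
                 ∀ k → f (List.lookup xs k) ≡ g (List.lookup xs k)
map-≡⇒lookup-≡ (x List.∷ xs) eq zero    = proj₁ (ListP.∷-injective eq)
map-≡⇒lookup-≡ (x List.∷ xs) eq (suc k) = map-≡⇒lookup-≡ xs (proj₂ (ListP.∷-injective eq)) k

Unique⇒lookup-≢ : ∀ {A : Set} {xs : List A} → Unique xs → ∀ j k → j ≢ k → List.lookup xs j ≢ List.lookup xs k
Unique⇒lookup-≢ (_ AllPairs.∷ _)     zero    zero    j≢k = ⊥-elim (j≢k refl)
Unique⇒lookup-≢ (x∉xs AllPairs.∷ _)  zero    (suc k) _   = All.lookup x∉xs (∈-lookup k)
Unique⇒lookup-≢ (x∉xs AllPairs.∷ _)  (suc j) zero    _   = All.lookup x∉xs (∈-lookup j) ∘ sym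
Unique⇒lookup-≢ (_ AllPairs.∷ uniq) (suc j) (suc k) j≢k = Unique⇒lookup-≢ uniq j k (j≢k ∘ cong suc)

module _ {n : ℕ} (m w M : ℕ) .{{_ : NonZero w}} .{{_ : NonZero M}} (I : List (Vec ℕ n)) where

  record Linked (x y : Vec ℕ n) : Set where
    constructor linked
    field
      coefficients : Fin (length I) → ℤ
      offset       : Offset (List.lookup I) coefficients x y
      same-blocks  : block M I y ≡ block M I x

  linked-sym : ∀ {x y} → Linked x y → Linked y x
  linked-sym {x} {y} (linked t x→y same) =
    linked (ℤ.-_ ∘ t) (offset-sym (List.lookup I) {t} {x} {y} x→y) (sym same)

  linked-trans : ∀ {x y z} → Linked x y → Linked y z → Linked x z
  linked-trans {x} {y} {z} (linked s x→y same₁) (linked t y→z same₂) =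
    linked (λ k → s k ℤ.+ t k) (offset-trans (List.lookup I) {s} {t} {x} {y} {z} x→y y→z) (trans same₂ same₁)

  summand : (Fin (length I) → ℤ) → Fin n → Fin (length I) → ℤ
  summand t j k = t k ℤ.* + lookup (List.lookup I k) j

  inSubspace⇒linked : ∀ {x y} → InSubspace m w M I x y → Linked x y
  inSubspace⇒linked {x} {y} (_ , t , _ , x→y , same) =
    linked t (λ j → trans (x→y j) (cong (ℤ._+_ (+ lookup x j)) (sumℤ≡∑ (length I) (summand t j)))) same

  inSubspace? : ∀ x y → Dec (InSubspace m w M I x y)
  inSubspace? x y = VAll.all? (ℕ._<? m) y ×-dec
    map′ (λ (t , _ , p) → t , p) (λ (t , p) → t , bounded t (proj₁ p) , p)
         (∃-bounded? (length I) (2 ℕ.* M) P? P-resp)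
    where
    Bound : ℤ → Set
    Bound h = (+ ∣ h ∣) ℚ./ 1 ℚ.≤ (+ (2 ℕ.* M)) ℚ./ w
    Step : (Fin (length I) → ℤ) → Fin n → Set
    Step t j = + lookup y j ≡ + lookup x j ℤ.+ sumℤ (length I) (summand t j)
    P : (Fin (length I) → ℤ) → Set
    P t = (∀ k → Bound (t k)) × (∀ j → Step t j) × block M I y ≡ block M I x
    P? : Decidable P
    P? t = FinP.all? (λ k → _ ℚP.≤? _) ×-dec FinP.all? (λ j → _ ℤ.≟ _) ×-dec ListP.≡-dec ℕ._≟_ _ _
    P-resp : ∀ {t t'} → (∀ k → t k ≡ t' k) → P t → P t'
    P-resp t≗t' (bound , step , same) =
      (λ k → subst Bound (t≗t' k) (bound k)) ,
      (λ j → trans (step j) (cong (ℤ._+_ (+ lookup x j)) (sumℤ-cong (length I) λ k →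
                                 cong (ℤ._* + lookup (List.lookup I k) j) (t≗t' k)))) ,
      same
    bounded : ∀ t → (∀ k → Bound (t k)) → ∀ k → ∣ t k ∣ ≤ 2 ℕ.* M
    bounded t bound k = ℕP.≤-trans (ℕP.m≤m*n ∣ t k ∣ w) (Equivalence.to (ℕ/1≤ℕ/w⇔*≤ ∣ t k ∣ (2 ℕ.* M) w) (bound k))

  module _ (norm : ∀ k → ⟪ List.lookup I k , List.lookup I k ⟫ ≡ w)
           (orth : ∀ j k → j ≢ k → 2 ℕ.* length I ℕ.* ⟪ List.lookup I j , List.lookup I k ⟫ ≤ w) where

    linked⇒inSubspace : ∀ {x y} → InRange m y → Linked x y → InSubspace m w M I x y
    linked⇒inSubspace {x} {y} y∈[m] (linked t x→y same) =
      y∈[m] , t ,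
      (λ k → Equivalence.from (ℕ/1≤ℕ/w⇔*≤ ∣ t k ∣ (2 ℕ.* M) w)
               (offset-coefficient-bound (List.lookup I) norm orth {t} {x} {y} x→y
                  (map-≡⇒lookup-≡ I same) k)) ,
      (λ j → trans (x→y j) (cong (ℤ._+_ (+ lookup x j)) (sym (sumℤ≡∑ (length I) (summand t j))))) ,
      same

    subspace-≡-or-disjoint : ∀ x x' → InRange m x' →
      (∀ y → InSubspace m w M I x y ⇔ InSubspace m w M I x' y)
      ⊎ (∀ y → InSubspace m w M I x y → InSubspace m w M I x' y → ⊥)
    subspace-≡-or-disjoint x x' x'∈[m] with inSubspace? x x'
    ... | yes x'∈Sx = inj₁ λ y → mk⇔
      (λ y∈Sx  → linked⇒inSubspace (proj₁ y∈Sx)  (linked-trans (linked-sym x→x') (inSubspace⇒linked {x} {y} y∈Sx)))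
      (λ y∈Sx' → linked⇒inSubspace (proj₁ y∈Sx') (linked-trans x→x' (inSubspace⇒linked {x'} {y} y∈Sx')))
      where x→x' = inSubspace⇒linked {x} {x'} x'∈Sx
    ... | no x'∉Sx = inj₂ λ y y∈Sx y∈Sx' → x'∉Sx (linked⇒inSubspace x'∈[m]
      (linked-trans (inSubspace⇒linked {x} {y} y∈Sx) (linked-sym (inSubspace⇒linked {x'} {y} y∈Sx'))))

mainTheorem9 : (n m w M : ℕ) .{{_ : NonZero w}} .{{_ : NonZero M}} (ε : ℚ)
    (F : List (Vec ℕ n)) → Unique F
    → All (λ u → IsBinary u × hammingWeight u ≡ w) F
    → (∀ u v → u ∈ F → v ∈ F → u ≢ v → (+ ⟪ u , v ⟫) ℚ./ 1 ℚ.≤ ε ℚ.* ((+ w) ℚ./ 1))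
    → (I : List (Vec ℕ n)) → Unique I → All (_∈ F) I
    → 0ℚ ℚ.< ε → ε ℚ.* ((+ (10 ℕ.* length I)) ℚ./ 1) ℚ.< 1ℚ
    → (x x' : Vec ℕ n) → InRange m x → InRange m x'
    → (∀ y → InSubspace m w M I x y ⇔ InSubspace m w M I x' y)
    ⊎ (∀ y → InSubspace m w M I x y → InSubspace m w M I x' y → ⊥)
mainTheorem9 n m w M ε F _ F-weights F-orth I I-unique I⊆F ε>0 ε-small x x' _ x'∈[m] =
  subspace-≡-or-disjoint m w M I norm orth x x' x'∈[m]
  where
  i : Fin (length I) → Vec ℕ n
  i = List.lookup I
  i∈F : ∀ k → i k ∈ F
  i∈F k = All.lookup I⊆F (∈-lookup k)
  norm : ∀ k → ⟪ i k , i k ⟫ ≡ w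
  norm k = let binary , weight = All.lookup F-weights (i∈F k)
           in trans (⟪u,u⟫≡hammingWeight (i k) binary) weight
  orth : ∀ j k → j ≢ k → 2 ℕ.* length I ℕ.* ⟪ i j , i k ⟫ ≤ w
  orth j k j≢k = e≤εw∧10Lε<1⇒2Le≤w {L = length I} ε>0
    (F-orth _ _ (i∈F j) (i∈F k) (Unique⇒lookup-≢ I-unique j k j≢k)) ε-small
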